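{- Let $\sigma\ge1$ and $k\ge2$, and let $w$ be a string over an alphabet of size $\sigma$. If $\sigma\le 2$ or $k\le 3$, and $w$ is $k$-covering, then $w$ is also $(k-1)$-covering.
   Context: Let $\Sigma=\{a_1<\dots<a_\sigma\}$. For a string $u$, $\mathbf{pv}(u)\in\mathbb{N}^\sigma$ has $i$-th entry the number of occurrences of $a_i$ in $u$; the order of a Parikh vector is the sum of its entries. A string $w$ over $\Sigma$ is $k$-covering (i.e. $(k,\sigma)$-covering) if for every Parikh vector $p\in\mathbb{N}^\sigma$ of order $k$ there is a substring $u$ of $w$ with $\mathbf{pv}(u)=p$. -}

module Defs where

open import Data.Nat using (ℕ; zero; suc; _+_)
open import Data.Fin using (Fin; _≟_)
open import Data.List using (List; _++_; length; filter)
open import Data.Product using (Σ; ∃; _×_; _,_)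
open import Data.Vec.Functional using (Vector)
import Data.Vec.Functional as VF
open import Relation.Binary.PropositionalEquality using (_≡_)
open import Relation.Nullary.Decidable using (⌊_⌋)

-- The alphabet of size σ is Fin σ, ordered a₁ < … < a_σ as 0 < … < σ-1.
-- A string over it is a list of letters.
Str : ℕ → Set
Str σ = List (Fin σ)

ParikhVec : ℕ → Set
ParikhVec σ = Vector ℕ σ

count : ∀ {σ} → Fin σ → Str σ → ℕ
count a u = length (filter (λ b → b ≟ a) u)

pv : ∀ {σ} → Str σ → ParikhVec σ
pv u i = count i u

order : ∀ {σ} → ParikhVec σ → ℕ
order {σ} p = VF.foldr _+_ 0 p

_IsSubstringOf_ : ∀ {σ} → Str σ → Str σ → Set
_IsSubstringOf_ {σ} u w = Σ (Str σ) λ x → Σ (Str σ) λ y → w ≡ x ++ u ++ y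

Covering : ∀ {σ} → ℕ → Str σ → Set
Covering {σ} k w =
  (p : ParikhVec σ) → order p ≡ k →
  Σ (Str σ) λ u → (u IsSubstringOf w) × (∀ i → pv u i ≡ p i)

-- For k ≤ 3: if p has order k − 1 and p_j > 0, a factor u with Parikh vector
-- p + e_j has length at most 3 and contains a_j twice, so u begins or ends with
-- a_j; deleting that letter leaves a factor with Parikh vector p.  For σ = 1 a
-- factor realising p + e_1 may always be trimmed at its head.  For σ = 2,
-- trimming the heads of factors realising p + e_1 and p + e_2 yields two
-- factors of length k − 1, one with at least and one with at most p_1
-- occurrences of a_1.  Sliding a window of length k − 1 from one to the other
-- changes that number by at most one per step, so some window contains exactly
-- p_1 letters a_1, and over two letters this fixes its Parikh vector.
module Submission where

open import Defs
open import Data.Nat using (ℕ; zero; suc; _+_; _∸_; _≤_; _<_; z≤n; s≤s)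
open import Data.Nat as ℕ using ()
open import Data.Nat.Properties hiding (_≟_)
open import Algebra.Properties.CommutativeSemigroup +-commutativeSemigroup using (interchange)
open import Data.Fin using (Fin; zero; suc; _≟_)
open import Data.List using (List; []; _∷_; _++_; [_]; length; filter; take; drop)
open import Data.List.Properties using (++-assoc; ++-identityʳ; length-++; length-filter; length-take; length-drop; take++drop≡id; filter-++; filter-accept; filter-reject)
open import Data.Product using (∃; _×_; _,_; proj₁; proj₂)
open import Function using (_∘_)
open import Data.Sum using (_⊎_; inj₁; inj₂)
import Data.Sum as Sum
open import Data.Empty using (⊥-elim)
open import Data.Vec.Functional using (zipWith; tail)
open import Relation.Nullary using (yes; no)
open import Relation.Binary.PropositionalEquality using (_≡_; refl; sym; trans; cong; cong₂; subst; _≗_; module ≡-Reasoning)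

private variable
  σ : ℕ

count-++ : (a : Fin σ) (u v : Str σ) → count a (u ++ v) ≡ count a u + count a v
count-++ a u v = trans (cong length (filter-++ (_≟ a) u v)) (length-++ (filter (_≟ a) u))

count≤length : (a : Fin σ) (u : Str σ) → count a u ≤ length u
count≤length a = length-filter (_≟ a)

count-[a]-a : (a : Fin σ) → count a [ a ] ≡ 1
count-[a]-a a = cong length (filter-accept (_≟ a) refl)

count-suc-[suc] : (a b : Fin σ) → count (suc a) [ suc b ] ≡ count a [ b ]
count-suc-[suc] a b with b ≟ a
... | yes _ = refl
... | no _ = refl

_+ᵥ_ : ParikhVec σ → ParikhVec σ → ParikhVec σ
_+ᵥ_ = zipWith _+_

order-cong : {p q : ParikhVec σ} → p ≗ q → order p ≡ order q
order-cong {zero}  eq = refl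
order-cong {suc σ} eq = cong₂ _+_ (eq zero) (order-cong (eq ∘ suc))

order-+ : (p q : ParikhVec σ) → order (p +ᵥ q) ≡ order p + order q
order-+ {zero}  p q = refl
order-+ {suc σ} p q =
  trans (cong (p zero + q zero +_) (order-+ (tail p) (tail q)))
        (interchange (p zero) (q zero) (order (tail p)) (order (tail q)))

order-pv-[] : order (pv {σ} []) ≡ 0
order-pv-[] {zero}  = refl
order-pv-[] {suc σ} = order-pv-[] {σ}

order-pv-[_] : (a : Fin σ) → order (pv [ a ]) ≡ 1
order-pv-[_] {suc σ} zero    = cong suc (order-pv-[] {σ})
order-pv-[_] {suc σ} (suc a) = trans (order-cong λ i → count-suc-[suc] i a) order-pv-[ a ]

pv-∷ : (b : Fin σ) (u : Str σ) → pv (b ∷ u) ≗ pv [ b ] +ᵥ pv u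
pv-∷ b u i = count-++ i [ b ] u

order-pv : (u : Str σ) → order (pv u) ≡ length u
order-pv {σ} []    = order-pv-[] {σ}
order-pv (b ∷ u) = begin
  order (pv (b ∷ u))            ≡⟨ order-cong (pv-∷ b u) ⟩
  order (pv [ b ] +ᵥ pv u)      ≡⟨ order-+ (pv [ b ]) (pv u) ⟩
  order (pv [ b ]) + order (pv u) ≡⟨ cong₂ _+_ order-pv-[ b ] (order-pv u) ⟩
  suc (length u)                ∎
  where open ≡-Reasoning

length-realiser : {u : Str σ} {p : ParikhVec σ} → pv u ≗ p → length u ≡ order p
length-realiser {u = u} eq = trans (sym (order-pv u)) (order-cong eq)

order-[a]+ᵥ : (a : Fin σ) (p : ParikhVec σ) → order (pv [ a ] +ᵥ p) ≡ suc (order p)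
order-[a]+ᵥ a p = trans (order-+ (pv [ a ]) p) (cong (_+ order p) order-pv-[ a ])

positive-entry : (p : ParikhVec σ) → 0 < order p → ∃ λ j → 0 < p j
positive-entry {suc σ} p pos with p zero in eq
... | suc _ = zero , subst (0 <_) (sym eq) (s≤s z≤n)
... | zero  with j , pj ← positive-entry (tail p) pos = suc j , pj

length-tail-realiser : {j : Fin σ} {p : ParikhVec σ} (x : Fin σ) (r : Str σ) →
  pv (x ∷ r) ≗ pv [ j ] +ᵥ p → length r ≡ order p
length-tail-realiser {j = j} {p} x r eq =
  suc-injective (trans (length-realiser {u = x ∷ r} eq) (order-[a]+ᵥ j p))

substring-trans : {u v w : Str σ} → u IsSubstringOf v → v IsSubstringOf w → u IsSubstringOf w
substring-trans {u = u} (x , y , refl) (x′ , y′ , refl) = x′ ++ x , y ++ y′ , (begin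
  x′ ++ (x ++ u ++ y) ++ y′  ≡⟨ cong (x′ ++_) (++-assoc x (u ++ y) y′) ⟩
  x′ ++ x ++ (u ++ y) ++ y′  ≡⟨ cong (λ z → x′ ++ x ++ z) (++-assoc u y y′) ⟩
  x′ ++ x ++ u ++ y ++ y′    ≡⟨ ++-assoc x′ x (u ++ y ++ y′) ⟨
  (x′ ++ x) ++ u ++ y ++ y′  ∎)
  where open ≡-Reasoning

substring-∷ : (a : Fin σ) (u : Str σ) → u IsSubstringOf (a ∷ u)
substring-∷ a u = [ a ] , [] , cong (a ∷_) (sym (++-identityʳ u))

substring-∷ʳ : (a : Fin σ) (u : Str σ) → u IsSubstringOf (u ++ [ a ])
substring-∷ʳ a u = [] , [ a ] , refl

_OccursIn_ : ParikhVec σ → Str σ → Set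
p OccursIn w = ∃ λ u → u IsSubstringOf w × pv u ≗ p

occurs-[_]+ᵥ : {k : ℕ} {w : Str σ} {p : ParikhVec σ} → (j : Fin σ) →
  Covering (suc k) w → order p ≡ k → (pv [ j ] +ᵥ p) OccursIn w
occurs-[_]+ᵥ {p = p} j cov ord = cov (pv [ j ] +ᵥ p) (trans (order-[a]+ᵥ j p) (cong suc ord))

trim : {w u : Str σ} {j : Fin σ} {p : ParikhVec σ} → u IsSubstringOf w → pv u ≗ pv [ j ] +ᵥ p →
  (∃ λ v → u ≡ j ∷ v) ⊎ (∃ λ v → u ≡ v ++ [ j ]) → p OccursIn w
trim {j = j} sub eq (inj₁ (v , refl)) = v , substring-trans (substring-∷ j v) sub ,
  λ i → +-cancelˡ-≡ (count i [ j ]) _ _ (trans (sym (pv-∷ j v i)) (eq i))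
trim {j = j} sub eq (inj₂ (v , refl)) = v , substring-trans (substring-∷ʳ j v) sub ,
  λ i → +-cancelˡ-≡ (count i [ j ]) _ _
          (trans (+-comm (count i [ j ]) (count i v)) (trans (sym (count-++ i v [ j ])) (eq i)))

end-letter : (j a c : Fin σ) (m : Str σ) → length m < count j (a ∷ m ++ [ c ]) → a ≡ j ⊎ c ≡ j
end-letter j a c m more with a ≟ j | c ≟ j
... | yes a≡j | _       = inj₁ a≡j
... | no _    | yes c≡j = inj₂ c≡j
... | no a≢j  | no c≢j  = ⊥-elim (<⇒≱ more (begin
  count j (m ++ [ c ])       ≡⟨ count-++ j m [ c ] ⟩
  count j m + count j [ c ]  ≡⟨ cong (λ n → count j m + length n) (filter-reject (_≟ j) c≢j) ⟩
  count j m + 0              ≡⟨ +-identityʳ (count j m) ⟩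
  count j m                  ≤⟨ count≤length j m ⟩
  length m                   ∎))
  where open ≤-Reasoning

head-or-last : (j : Fin σ) (u : Str σ) → length u ≤ 3 → 2 ≤ count j u →
  (∃ λ v → u ≡ j ∷ v) ⊎ (∃ λ v → u ≡ v ++ [ j ])
head-or-last j [] _ ()
head-or-last j (a ∷ []) _ twice = ⊥-elim (≤⇒≯ (count≤length j [ a ]) twice)
head-or-last j (a ∷ b ∷ []) _ twice with end-letter j a b [] (≤-trans (s≤s z≤n) twice)
... | inj₁ refl = inj₁ (b ∷ [] , refl)
... | inj₂ refl = inj₂ (a ∷ [] , refl)
head-or-last j (a ∷ b ∷ c ∷ []) _ twice with end-letter j a c [ b ] twice
... | inj₁ refl = inj₁ (b ∷ c ∷ [] , refl)
... | inj₂ refl = inj₂ (a ∷ b ∷ [] , refl)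
head-or-last j (_ ∷ _ ∷ _ ∷ _ ∷ _) (s≤s (s≤s (s≤s ()))) _

covering-pred-short : {k : ℕ} {w : Str σ} → 1 ≤ k → k ≤ 2 → Covering (suc k) w → Covering k w
covering-pred-short 1≤k k≤2 cov p refl
  with j , pj ← positive-entry p 1≤k
  with u , sub , eq ← occurs-[ j ]+ᵥ cov refl
  = trim sub eq (head-or-last j u short twice)
  where
  short : length u ≤ 3
  short = ≤-trans (≤-reflexive (trans (length-realiser {u = u} eq) (order-[a]+ᵥ j p))) (s≤s k≤2)
  twice : 2 ≤ count j u
  twice = subst (2 ≤_) (sym (trans (eq j) (cong (_+ p j) (count-[a]-a j)))) (s≤s pj)

window : {A : Set} → ℕ → ℕ → List A → List A
window n i xs = take n (drop i xs)

window-substring : (n i : ℕ) (w : Str σ) → window n i w IsSubstringOf w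
window-substring n i w = take i w , drop n (drop i w) , sym (begin
  take i w ++ take n (drop i w) ++ drop n (drop i w)  ≡⟨ cong (take i w ++_) (take++drop≡id n (drop i w)) ⟩
  take i w ++ drop i w                                ≡⟨ take++drop≡id i w ⟩
  w                                                   ∎)
  where open ≡-Reasoning

length-window : {A : Set} (n i : ℕ) (xs : List A) → i + n ≤ length xs → length (window n i xs) ≡ n
length-window n i xs fits = trans (length-take n (drop i xs)) (m≤n⇒m⊓n≡m (begin
  n                ≤⟨ m+n≤o⇒m≤o∸n n (subst (_≤ length xs) (+-comm i n) fits) ⟩
  length xs ∸ i    ≡⟨ length-drop i xs ⟨
  length (drop i xs) ∎))
  where open ≤-Reasoning

window-++ : {A : Set} (x u y : List A) → window (length u) (length x) (x ++ u ++ y) ≡ u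
window-++ []      []      y = refl
window-++ []      (a ∷ u) y = cong (a ∷_) (window-++ [] u y)
window-++ (_ ∷ x) u       y = window-++ x u y

substring⇒window : {n : ℕ} {u w : Str σ} → length u ≡ n → u IsSubstringOf w →
  ∃ λ i → i + n ≤ length w × window n i w ≡ u
substring⇒window {u = u} refl (x , y , refl) = length x , fits , window-++ x u y
  where
  fits : length x + length u ≤ length (x ++ u ++ y)
  fits = begin
    length x + length u                ≤⟨ +-monoʳ-≤ (length x) (m≤m+n (length u) (length y)) ⟩
    length x + (length u + length y)   ≡⟨ cong (length x +_) (length-++ u) ⟨
    length x + length (u ++ y)         ≡⟨ length-++ x ⟨
    length (x ++ u ++ y)               ∎
    where open ≤-Reasoning

take-suc-++ : {A : Set} (m : ℕ) (xs : List A) → take (suc m) xs ≡ take m xs ++ take 1 (drop m xs)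
take-suc-++ zero    xs       = refl
take-suc-++ (suc m) []       = refl
take-suc-++ (suc m) (x ∷ xs) = cong (x ∷_) (take-suc-++ m xs)

m≤n≤1+m : {m n d : ℕ} → n ≡ m + d → d ≤ 1 → m ≤ n × n ≤ suc m
m≤n≤1+m {m} {d = d} refl d≤1 = m≤m+n m d , subst (m + d ≤_) (+-comm m 1) (+-monoʳ-≤ m d≤1)

count-∷-bounds : (a b : Fin σ) (u : Str σ) → count a u ≤ count a (b ∷ u) × count a (b ∷ u) ≤ suc (count a u)
count-∷-bounds a b u = m≤n≤1+m (trans (count-++ a [ b ] u) (+-comm (count a [ b ]) (count a u))) (count≤length a [ b ])

count-take-suc-bounds : (a : Fin σ) (m : ℕ) (z : Str σ) →
  count a (take m z) ≤ count a (take (suc m) z) × count a (take (suc m) z) ≤ suc (count a (take m z))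
count-take-suc-bounds {σ} a m z = m≤n≤1+m (trans (cong (count a) (take-suc-++ m z)) (count-++ a (take m z) _)) (at-most-one (drop m z))
  where
  at-most-one : (xs : Str σ) → count a (take 1 xs) ≤ 1
  at-most-one []      = z≤n
  at-most-one (x ∷ _) = count≤length a [ x ]

count-take-∷ : (a x : Fin σ) (n : ℕ) (z : Str σ) →
  count a (take n z) ≤ suc (count a (take n (x ∷ z))) × count a (take n (x ∷ z)) ≤ suc (count a (take n z))
count-take-∷ a x zero    z = z≤n , z≤n
count-take-∷ a x (suc m) z with ≤-take , take-≤ ← count-take-suc-bounds a m z
                             | ≤-∷ , ∷-≤ ← count-∷-bounds a x (take m z)
  = ≤-trans take-≤ (s≤s ≤-∷) , ≤-trans ∷-≤ (s≤s ≤-take)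

count-window-suc : (a : Fin σ) (n i : ℕ) (w : Str σ) →
  count a (window n (suc i) w) ≤ suc (count a (window n i w)) ×
  count a (window n i w) ≤ suc (count a (window n (suc i) w))
count-window-suc a n zero    []      = n≤1+n _ , n≤1+n _
count-window-suc a n zero    (x ∷ z) = count-take-∷ a x n z
count-window-suc a n (suc i) []      = n≤1+n _ , n≤1+n _
count-window-suc a n (suc i) (_ ∷ w) = count-window-suc a n i w

intermediate-value-↑ : (f : ℕ → ℕ) → (∀ t → f (suc t) ≤ suc (f t)) →
  {c i j : ℕ} → i ≤ j → f i ≤ c → c ≤ f j → ∃ λ t → t ≤ j × f t ≡ c
intermediate-value-↑ f step {j = zero} z≤n fi≤c c≤fj = 0 , z≤n , ≤-antisym fi≤c c≤fj
intermediate-value-↑ f step {c} {i} {suc j} i≤j fi≤c c≤fj with f (suc j) ℕ.≟ c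
... | yes fj≡c = suc j , ≤-refl , fj≡c
... | no fj≢c with m≤n⇒m<n∨m≡n i≤j
...   | inj₂ refl = ⊥-elim (fj≢c (≤-antisym fi≤c c≤fj))
...   | inj₁ (s≤s i≤j′)
  with t , t≤j , ft≡c ← intermediate-value-↑ f step i≤j′ fi≤c
                          (≤-pred (≤-trans (≤∧≢⇒< c≤fj (fj≢c ∘ sym)) (step j)))
  = t , m≤n⇒m≤1+n t≤j , ft≡c

intermediate-value-↓ : (f : ℕ → ℕ) → (∀ t → f t ≤ suc (f (suc t))) →
  {c i j : ℕ} → i ≤ j → c ≤ f i → f j ≤ c → ∃ λ t → t ≤ j × f t ≡ c
intermediate-value-↓ f step {j = zero} z≤n c≤fi fj≤c = 0 , z≤n , ≤-antisym fj≤c c≤fi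
intermediate-value-↓ f step {c} {i} {suc j} i≤j c≤fi fj≤c with f (suc j) ℕ.≟ c
... | yes fj≡c = suc j , ≤-refl , fj≡c
... | no fj≢c with m≤n⇒m<n∨m≡n i≤j
...   | inj₂ refl = ⊥-elim (fj≢c (≤-antisym fj≤c c≤fi))
...   | inj₁ (s≤s i≤j′)
  with t , t≤j , ft≡c ← intermediate-value-↓ f step i≤j′ c≤fi
                          (≤-trans (step j) (≤∧≢⇒< fj≤c fj≢c))
  = t , m≤n⇒m≤1+n t≤j , ft≡c

factor-with-count : (a : Fin σ) {n c : ℕ} {w u v : Str σ} →
  u IsSubstringOf w → v IsSubstringOf w → length u ≡ n → length v ≡ n →
  count a u ≤ c → c ≤ count a v →
  ∃ λ m → m IsSubstringOf w × length m ≡ n × count a m ≡ c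
factor-with-count a {n} {c} {w} u⊑w v⊑w ∣u∣ ∣v∣ cu cv
  with i , i-fits , u-at-i ← substring⇒window ∣u∣ u⊑w
     | j , j-fits , v-at-j ← substring⇒window ∣v∣ v⊑w
  = Sum.[ (λ i≤j → found j-fits (intermediate-value-↑ f (proj₁ ∘ step) i≤j fi≤c c≤fj))
    , (λ j≤i → found i-fits (intermediate-value-↓ f (proj₂ ∘ step) j≤i c≤fj fi≤c))
    ] (≤-total i j)
  where
  f : ℕ → ℕ
  f t = count a (window n t w)
  step : ∀ t → f (suc t) ≤ suc (f t) × f t ≤ suc (f (suc t))
  step t = count-window-suc a n t w
  fi≤c : f i ≤ c
  fi≤c = subst (λ s → count a s ≤ c) (sym u-at-i) cu
  c≤fj : c ≤ f j
  c≤fj = subst (λ s → c ≤ count a s) (sym v-at-j) cv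
  found : ∀ {l} → l + n ≤ length w → (∃ λ t → t ≤ l × f t ≡ c) →
    ∃ λ m → m IsSubstringOf w × length m ≡ n × count a m ≡ c
  found fits (t , t≤l , ft≡c) =
    window n t w , window-substring n t w , length-window n t w (≤-trans (+-monoˡ-≤ n t≤l) fits) , ft≡c

pv-binary : {m : Str 2} {p : ParikhVec 2} → length m ≡ order p → count zero m ≡ p zero → pv m ≗ p
pv-binary         len c₀ zero       = c₀
pv-binary {m} {p} len c₀ (suc zero) = +-cancelʳ-≡ 0 _ _ (+-cancelˡ-≡ (p zero) _ _ (begin
  p zero + (count (suc zero) m + 0)     ≡⟨ cong (_+ (count (suc zero) m + 0)) c₀ ⟨
  count zero m + (count (suc zero) m + 0) ≡⟨ order-pv m ⟩
  length m                              ≡⟨ len ⟩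
  p zero + (p (suc zero) + 0)           ∎))
  where open ≡-Reasoning

covering-pred-unary : {k : ℕ} {w : Str 1} → Covering (suc k) w → Covering k w
covering-pred-unary cov p ord with occurs-[ zero ]+ᵥ cov ord
... | []       , _   , more = ⊥-elim (0≢1+n (more zero))
... | zero ∷ v , sub , more = trim sub more (inj₁ (v , refl))

covering-pred-binary : {k : ℕ} {w : Str 2} → Covering (suc k) w → Covering k w
covering-pred-binary {k} {w} cov p ord with occurs-[ zero ]+ᵥ cov ord | occurs-[ suc zero ]+ᵥ cov ord
... | []    , _     , more₀ | _                   = ⊥-elim (0≢1+n (more₀ zero))
... | _                     | []    , _    , more₁ = ⊥-elim (0≢1+n (more₁ (suc zero)))
... | h ∷ u , hu⊑w , more₀ | g ∷ v , gv⊑w , more₁ =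
  realise (factor-with-count zero v⊑w u⊑w ∣v∣ ∣u∣ v₀≤p₀ p₀≤u₀)
  where
  u⊑w : u IsSubstringOf w
  u⊑w = substring-trans (substring-∷ h u) hu⊑w
  v⊑w : v IsSubstringOf w
  v⊑w = substring-trans (substring-∷ g v) gv⊑w
  ∣u∣ : length u ≡ k
  ∣u∣ = trans (length-tail-realiser {j = zero} {p} h u more₀) ord
  ∣v∣ : length v ≡ k
  ∣v∣ = trans (length-tail-realiser {j = suc zero} {p} g v more₁) ord
  p₀≤u₀ : p zero ≤ count zero u
  p₀≤u₀ = ≤-pred (≤-trans (≤-reflexive (sym (more₀ zero))) (proj₂ (count-∷-bounds zero h u)))
  v₀≤p₀ : count zero v ≤ p zero
  v₀≤p₀ = ≤-trans (proj₁ (count-∷-bounds zero g v)) (≤-reflexive (more₁ zero))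
  realise : (∃ λ m → m IsSubstringOf w × length m ≡ k × count zero m ≡ p zero) → p OccursIn w
  realise (m , m⊑w , ∣m∣ , m₀) = m , m⊑w , pv-binary {m = m} {p} (trans ∣m∣ (sym ord)) m₀

proposition2 : (σ k : ℕ) → 1 ≤ σ → 2 ≤ k → (w : Str σ) →
    (σ ≤ 2 ⊎ k ≤ 3) → Covering k w → Covering (k ∸ 1) w
proposition2 _ (suc k) _ (s≤s 1≤k) _ (inj₂ (s≤s k≤2)) = covering-pred-short 1≤k k≤2
proposition2 1 (suc k) _ _ _ (inj₁ _)                = covering-pred-unary
proposition2 2 (suc k) _ _ _ (inj₁ _)                = covering-pred-binary
proposition2 (suc (suc (suc _))) _ _ _ _ (inj₁ (s≤s (s≤s ())))
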